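{- The structure $\langle\mathbb{P},\subseteq,\cup,0,1,;,\parallel\rangle$ consists of two unital quantales, $\langle\mathbb{P},\subseteq,;,1\rangle$ and $\langle\mathbb{P},\subseteq,\parallel,1\rangle$ (with join $\cup$), which together satisfy the exchange law $(\mathcal{U}\parallel\mathcal{V});(\mathcal{X}\parallel\mathcal{Y})\subseteq(\mathcal{U};\mathcal{X})\parallel(\mathcal{V};\mathcal{Y})$ for all $\mathcal{U},\mathcal{V},\mathcal{X},\mathcal{Y}\in\mathbb{P}$.
   Context: Fix an alphabet $\Gamma$ and a nonempty (infinite) set $E$ of events, large enough that the event sets of the compositions below are again subsets of $E$. A partial string is a triple $p=\langle E_p,\alpha_p,\preceq_p\rangle$ with $E_p\subseteq E$, $\alpha_p\colon E_p\to\Gamma$, and $\preceq_p$ a partial order on $E_p$; $\mathsf{P}_f$ is the set of finite partial strings; $\bot$ is the empty partial string. A monotonic bijective morphism $f\colon x\to y$ is a bijection $f\colon E_x\to E_y$ with $e\preceq_x e'\Rightarrow f(e)\preceq_y f(e')$ and $\alpha_x(e)=\alpha_y(f(e))$. Write $x\sqsubseteq y$ iff there is a monotonic bijective morphism $y\to x$. For sets $S,T$ let $S+T=(S\times\{0\})\cup(T\times\{1\})$. For partial strings $x,y$, $x\parallel y$ and $x;y$ both have event set $E_x+E_y$ and labelling $\alpha(\langle e,0\rangle)=\alpha_x(e)$, $\alpha(\langle e,1\rangle)=\alpha_y(e)$; the order of $x\parallel y$ is: $\langle e,i\rangle\preceq\langle e',j\rangle$ iff ($i=j=0$ and $e\preceq_x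 e'$) or ($i=j=1$ and $e\preceq_y e'$); the order of $x;y$ is: $\langle e,i\rangle\preceq\langle e',j\rangle$ iff $i<j$ or $\langle e,i\rangle\preceq_{x\parallel y}\langle e',j\rangle$. A program is a set $\mathcal{X}\subseteq\mathsf{P}_f$ with $\downarrow\mathcal{X}=\mathcal{X}$, where $\downarrow\mathcal{X}=\{y\in\mathsf{P}_f\mid\exists x\in\mathcal{X}\colon y\sqsubseteq x\}$; $\mathbb{P}$ is the family of programs. $0=\emptyset$, $1=\{\bot\}$. For programs and $\Join\in\{\parallel,;\}$, $\mathcal{X}\Join\mathcal{Y}=\downarrow\{x\Join y\mid x\in\mathcal{X},y\in\mathcal{Y}\}$. A unital quantale is a complete lattice $Q$ with a monoid structure $\langle Q,\cdot,1\rangle$ such that $x\cdot\bigvee S=\bigvee\{x\cdot y\mid y\in S\}$ and $(\bigvee S)\cdot x=\bigvee\{y\cdot x\mid y\in S\}$ for all $S\subseteq Q$, $x\in Q$. -}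

module Defs where

open import Level using (Level; 0ℓ; _⊔_; Lift; lift) renaming (suc to lsuc)
open import Data.Nat using (ℕ)
open import Data.Fin using (Fin; zero; suc) renaming (_<_ to _<ᶠ_)
open import Data.Bool using (Bool; true; false; T)
open import Data.Empty using (⊥)
open import Data.Sum using (_⊎_; inj₁; inj₂)
open import Data.Product using (Σ; _×_; _,_; proj₁; proj₂)
open import Data.List using (List)
open import Data.List.Membership.Propositional using (_∈_)
open import Function using (_∘_)
open import Function.Definitions using (Bijective)
import Function.Construct.Composition as Comp
import Function.Construct.Identity as Id
open import Relation.Binary.Core using (Rel)
open import Relation.Binary.Structures using (IsPartialOrder)
open import Relation.Binary.PropositionalEquality using (_≡_) renaming (refl to ≡-refl; trans to ≡-trans)
open import Algebra.Core using (Op₂)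
open import Algebra.Structures using (IsMonoid)

-- Arbitrary subsets
-- S ⊆ Q are represented (predicatively) as families indexed by a type
-- I : Set ι.

IsSupremum : ∀ {c ℓ ι} {C : Set c} (_≤_ : Rel C ℓ) {I : Set ι} → (I → C) → C → Set (c ⊔ ℓ ⊔ ι)
IsSupremum {C = C} _≤_ {I} F s =
  (∀ i → F i ≤ s) × (∀ (u : C) → (∀ i → F i ≤ u) → s ≤ u)

record IsUnitalQuantale {c ℓ₁ ℓ₂ ι} {C : Set c}
         (_≈_ : Rel C ℓ₁) (_≤_ : Rel C ℓ₂)
         (⋁ : {I : Set ι} → (I → C) → C)
         (_·_ : Op₂ C) (ε : C) : Set (c ⊔ ℓ₁ ⊔ ℓ₂ ⊔ lsuc ι) where
  field
    isPartialOrder : IsPartialOrder _≈_ _≤_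
    ⋁-supremum     : ∀ {I : Set ι} (F : I → C) → IsSupremum _≤_ F (⋁ F)
    isMonoid       : IsMonoid _≈_ _·_ ε
    distribˡ       : ∀ {I : Set ι} (x : C) (F : I → C) → (x · ⋁ F) ≈ ⋁ (λ i → x · F i)
    distribʳ       : ∀ {I : Set ι} (x : C) (F : I → C) → (⋁ F · x) ≈ ⋁ (λ i → F i · x)

-- It is nonempty and infinite (atom n for
-- every n) and closed under the tagging ⟨ e , i ⟩ (i ∈ {0,1}) used by
-- S + T = (S × {0}) ∪ (T × {1}), so that event sets of compositions are
-- again subsets of E.

data Event : Set where
  atom  : ℕ → Event
  ⟨_,_⟩ : Event → Fin 2 → Event

_+ₑ_ : (Event → Bool) → (Event → Bool) → Event → Bool
(S +ₑ U) (atom _)            = false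
(S +ₑ U) ⟨ e , zero ⟩        = S e
(S +ₑ U) ⟨ e , suc zero ⟩    = U e

module Programs (Γ : Set) where

  record PreStr : Set₁ where
    field
      Ev  : Event → Bool
      α   : Σ Event (λ e → T (Ev e)) → Γ
      _≼_ : Rel (Σ Event (λ e → T (Ev e))) 0ℓ

  open PreStr public

  El : PreStr → Set
  El p = Σ Event (λ e → T (Ev p e))

  IsPartialString : PreStr → Set
  IsPartialString p = IsPartialOrder _≡_ (_≼_ p)

  IsFinite : PreStr → Set
  IsFinite p = Σ (List Event) (λ xs → ∀ e → T (Ev p e) → e ∈ xs)

  Pf : PreStr → Set
  Pf p = IsPartialString p × IsFinite p

  ⊥ₛ : PreStr
  ⊥ₛ = record { Ev = λ _ → false ; α = λ { (_ , ()) } ; _≼_ = λ _ _ → ⊥ }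

  record _⟶_ (x y : PreStr) : Set where
    field
      fun  : El x → El y
      bij  : Bijective _≡_ _≡_ fun
      mono : ∀ {e e′} → _≼_ x e e′ → _≼_ y (fun e) (fun e′)
      lab  : ∀ e → α x e ≡ α y (fun e)

  _⊑_ : PreStr → PreStr → Set
  x ⊑ y = y ⟶ x

  ⊑-refl : ∀ x → x ⊑ x
  ⊑-refl x = record { fun = λ e → e ; bij = Id.bijective _≡_
                    ; mono = λ p → p ; lab = λ _ → ≡-refl }

  ⊑-trans : ∀ {x y z} → x ⊑ y → y ⊑ z → x ⊑ z
  ⊑-trans {x} {y} {z} f g = record
    { fun  = F.fun ∘ G.fun
    ; bij  = Comp.bijective _≡_ _≡_ _≡_ G.bij F.bij
    ; mono = F.mono ∘ G.mono
    ; lab  = λ e → ≡-trans (G.lab e) (F.lab (G.fun e))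
    }
    where module F = _⟶_ f
          module G = _⟶_ g

  module _ (x y : PreStr) where

    ElSum : Set
    ElSum = Σ Event (λ e → T ((Ev x +ₑ Ev y) e))

    αSum : ElSum → Γ
    αSum (atom _ , ())
    αSum (⟨ e , zero ⟩ , p)     = α x (e , p)
    αSum (⟨ e , suc zero ⟩ , p) = α y (e , p)

    index : ElSum → Fin 2
    index (atom _ , ())
    index (⟨ _ , i ⟩ , _) = i

    parOrd : Rel ElSum 0ℓ
    parOrd (⟨ e , zero ⟩ , p)     (⟨ e′ , zero ⟩ , q)     = _≼_ x (e , p) (e′ , q)
    parOrd (⟨ e , suc zero ⟩ , p) (⟨ e′ , suc zero ⟩ , q) = _≼_ y (e , p) (e′ , q)
    parOrd _ _ = ⊥

    seqOrd : Rel ElSum 0ℓ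
    seqOrd a b = (index a <ᶠ index b) ⊎ parOrd a b

  _∥ₛ_ : PreStr → PreStr → PreStr
  x ∥ₛ y = record { Ev = Ev x +ₑ Ev y ; α = αSum x y ; _≼_ = parOrd x y }

  _⨾ₛ_ : PreStr → PreStr → PreStr
  x ⨾ₛ y = record { Ev = Ev x +ₑ Ev y ; α = αSum x y ; _≼_ = seqOrd x y }

  PSet : Set₂
  PSet = PreStr → Set₁

  ↓ : PSet → PSet
  ↓ S y = Pf y × Σ PreStr (λ x → S x × y ⊑ x)

  record Program : Set₂ where
    field
      mem    : PSet
      ⊆Pf    : ∀ x → mem x → Pf x
      closed : ∀ y → (↓ mem y → mem y) × (mem y → ↓ mem y)

  open Program public

  ↓prog : PSet → Program
  ↓prog S = record
    { mem    = ↓ S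
    ; ⊆Pf    = λ _ → proj₁
    ; closed = λ y →
        (λ { (pf , x , (_ , z , Sz , x⊑z) , y⊑x) → pf , z , Sz , ⊑-trans y⊑x x⊑z })
      , (λ { (pf , x , Sx , y⊑x) → pf , y , (pf , x , Sx , y⊑x) , ⊑-refl y })
    }

  _⊆ₚ_ : Rel Program (lsuc 0ℓ)
  X ⊆ₚ Y = ∀ z → mem X z → mem Y z

  _≈ₚ_ : Rel Program (lsuc 0ℓ)
  X ≈ₚ Y = (X ⊆ₚ Y) × (Y ⊆ₚ X)

  0ₚ : Program
  0ₚ = record { mem = λ _ → Lift _ ⊥ ; ⊆Pf = λ { _ (lift ()) }
              ; closed = λ y → (λ { (_ , _ , lift () , _) }) , (λ { (lift ()) }) }

  -- 1 = {⊥}, taken as the program ↓{⊥}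
  1ₚ : Program
  1ₚ = ↓prog (λ x → x ≡ ⊥ₛ)

  _∪ₚ_ : Op₂ Program
  X ∪ₚ Y = record
    { mem    = λ z → mem X z ⊎ mem Y z
    ; ⊆Pf    = λ { z (inj₁ m) → ⊆Pf X z m ; z (inj₂ m) → ⊆Pf Y z m }
    ; closed = λ y →
        (λ { (pf , x , inj₁ m , y⊑x) → inj₁ (proj₁ (closed X y) (pf , x , m , y⊑x))
           ; (pf , x , inj₂ m , y⊑x) → inj₂ (proj₁ (closed Y y) (pf , x , m , y⊑x)) })
      , (λ { (inj₁ m) → ⊆Pf X y m , y , inj₁ m , ⊑-refl y
           ; (inj₂ m) → ⊆Pf Y y m , y , inj₂ m , ⊑-refl y })
    }

  ⋃ₚ : {I : Set₁} → (I → Program) → Program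
  ⋃ₚ {I} F = record
    { mem    = λ z → Σ I (λ i → mem (F i) z)
    ; ⊆Pf    = λ { z (i , m) → ⊆Pf (F i) z m }
    ; closed = λ y →
        (λ { (pf , x , (i , m) , y⊑x) → i , proj₁ (closed (F i) y) (pf , x , m , y⊑x) })
      , (λ { (i , m) → ⊆Pf (F i) y m , y , (i , m) , ⊑-refl y })
    }

  lift₂ : Op₂ PreStr → Op₂ Program
  lift₂ _⋈_ X Y = ↓prog (λ z → Σ PreStr (λ x → Σ PreStr (λ y →
                    mem X x × mem Y y × z ≡ (x ⋈ y))))

  _∥ₚ_ : Op₂ Program
  _∥ₚ_ = lift₂ _∥ₛ_

  _⨾ₚ_ : Op₂ Program
  _⨾ₚ_ = lift₂ _⨾ₛ_

-- Each law of the two program algebras is inherited from the same law for partial strings,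
-- where it holds up to ⊑ in both directions: ∥ₛ and ⨾ₛ are monotone for ⊑, associative,
-- and have every empty partial string as unit, each time witnessed by a relabelling of the
-- tagged events that preserves the orders.  For the exchange law, transposing the 2×2 grid of
-- blocks is a monotone bijection from (u ⨾ₛ x) ∥ₛ (v ⨾ₛ y) onto (u ∥ₛ v) ⨾ₛ (x ∥ₛ y): the
-- sequential-of-parallel order contains every constraint of the parallel-of-sequential one.
-- Down-closure turns these facts into inclusions of programs, and since lift₂ is defined
-- pointwise it commutes with arbitrary unions.
module Submission where

open import Defs
open import Data.Product using (_×_)
open import Relation.Binary.Lattice.Definitions using (Supremum)

open import Level using (0ℓ)
open import Data.Nat using (_<_; z<s)
open import Data.Nat.Properties using (<-irrefl)
open import Data.Fin using (zero; suc)
open import Data.Bool using (Bool; T)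
open import Data.Empty using (⊥; ⊥-elim)
open import Data.Sum using (_⊎_; inj₁; inj₂)
open import Data.Product using (Σ; _,_; proj₁; proj₂; swap)
open import Data.List using (List; []; map; _++_)
open import Data.List.Membership.Propositional using (_∈_)
open import Data.List.Membership.Propositional.Properties using (∈-map⁺; ∈-++⁺ˡ; ∈-++⁺ʳ)
open import Function.Bundles using (Inverse; Bijection; _↔_; mk↔ₛ′; mk⤖)
open import Function.Properties.Bijection using (⤖⇒↔)
open import Function.Properties.Inverse using (Inverse⇒Bijection)
open import Function.Construct.Symmetry using (↔-sym)
open import Relation.Nullary using (¬_)
open import Relation.Binary.Core using (Rel; _Preserves_⟶_)
open import Relation.Binary.Structures using (IsPartialOrder; IsEquivalence)
open import Relation.Binary.PropositionalEquality
  using (_≡_; refl; sym; trans; cong; isEquivalence)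
open import Algebra.Core using (Op₂)

-- The tags of seqOrd are compared in ℕ (Fin's _<_ unfolds to it): within a block only the
-- component order can hold, and nothing leads from block 1 back to block 0.
same-block : ∀ {n} {A : Set} → (n < n) ⊎ A → A
same-block (inj₁ n<n) = ⊥-elim (<-irrefl refl n<n)
same-block (inj₂ a)   = a

backwards : ∀ {n} {B : Set} → (n < 0) ⊎ ⊥ → B
backwards (inj₁ ())
backwards (inj₂ ())

pattern ⟨_⟩₀ e = ⟨ e , zero ⟩
pattern ⟨_⟩₁ e = ⟨ e , suc zero ⟩

Finite : (Event → Bool) → Set
Finite S = Σ (List Event) λ xs → ∀ e → T (S e) → e ∈ xs

+ₑ-finite : ∀ {S U} → Finite S → Finite U → Finite (S +ₑ U)
+ₑ-finite (xs , xs⊇S) (us , us⊇U) = tag₀ xs ++ tag₁ us , ⊇S+U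
  where
  tag₀ tag₁ : List Event → List Event
  tag₀ = map ⟨_⟩₀
  tag₁ = map ⟨_⟩₁
  ⊇S+U : ∀ e → T ((_ +ₑ _) e) → e ∈ tag₀ xs ++ tag₁ us
  ⊇S+U ⟨ e ⟩₀ p = ∈-++⁺ˡ (∈-map⁺ ⟨_⟩₀ (xs⊇S e p))
  ⊇S+U ⟨ e ⟩₁ p = ∈-++⁺ʳ (tag₀ xs) (∈-map⁺ ⟨_⟩₁ (us⊇U e p))

module PartialStringQuantales (Γ : Set) where
  open Programs Γ

  _≃_ : Rel PreStr 0ℓ
  x ≃ y = x ⊑ y × y ⊑ x

  IsEmpty : PreStr → Set
  IsEmpty x = ¬ El x

  ⊥ₛ-isEmpty : IsEmpty ⊥ₛ
  ⊥ₛ-isEmpty = proj₂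

  ⊑⊥ₛ⇒isEmpty : ∀ {x} → x ⊑ ⊥ₛ → IsEmpty x
  ⊑⊥ₛ⇒isEmpty f a = proj₂ (proj₁ (proj₂ (_⟶_.bij f) a))

  -- Stated through El and α only, so an isomorphism of x ∥ₛ y is also one of x ⨾ₛ y.
  _≅_ : PreStr → PreStr → Set
  x ≅ y = Σ (El x ↔ El y) λ f → ∀ a → α x a ≡ α y (Inverse.to f a)

  ≅-sym : ∀ {x y} → x ≅ y → y ≅ x
  ≅-sym {y = y} (f , α-to) =
    ↔-sym f , λ b → sym (trans (α-to (from b)) (cong (α y) (strictlyInverseˡ b)))
    where open Inverse f

  ⟶⇒≅ : ∀ {x y} → x ⟶ y → x ≅ y
  ⟶⇒≅ f = ⤖⇒↔ (mk⤖ bij) , lab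
    where open _⟶_ f

  ≅⇒⟶ : ∀ {x y} (i : x ≅ y) → Inverse.to (proj₁ i) Preserves _≼_ x ⟶ _≼_ y → x ⟶ y
  ≅⇒⟶ (f , α-to) to-mono = record
    { fun  = Inverse.to f
    ; bij  = Bijection.bijective (Inverse⇒Bijection f)
    ; mono = to-mono
    ; lab  = α-to
    }

  ≅⇒≃ : ∀ {x y} (i : x ≅ y) →
        Inverse.to (proj₁ i) Preserves _≼_ x ⟶ _≼_ y →
        Inverse.from (proj₁ i) Preserves _≼_ y ⟶ _≼_ x → x ≃ y
  ≅⇒≃ {x} {y} i to-mono from-mono = ≅⇒⟶ (≅-sym {x} {y} i) from-mono , ≅⇒⟶ i to-mono

  ι₀ : ∀ x y → El x → El (x ∥ₛ y)
  ι₀ x y a = ⟨ proj₁ a ⟩₀ , proj₂ a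

  ι₁ : ∀ x y → El y → El (x ∥ₛ y)
  ι₁ x y a = ⟨ proj₁ a ⟩₁ , proj₂ a

  module _ (x y : PreStr) (px : IsPartialString x) (py : IsPartialString y) where
    private
      module X = IsPartialOrder px
      module Y = IsPartialOrder py

    parOrd-refl : ∀ a → parOrd x y a a
    parOrd-refl (⟨ e ⟩₀ , p) = X.refl
    parOrd-refl (⟨ e ⟩₁ , p) = Y.refl

    parOrd-trans : ∀ a b c → parOrd x y a b → parOrd x y b c → parOrd x y a c
    parOrd-trans (⟨ _ ⟩₀ , _) (⟨ _ ⟩₀ , _) (⟨ _ ⟩₀ , _) r  s = X.trans r s
    parOrd-trans (⟨ _ ⟩₀ , _) (⟨ _ ⟩₀ , _) (⟨ _ ⟩₁ , _) r  ()
    parOrd-trans (⟨ _ ⟩₀ , _) (⟨ _ ⟩₁ , _) _            () s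
    parOrd-trans (⟨ _ ⟩₁ , _) (⟨ _ ⟩₀ , _) _            () s
    parOrd-trans (⟨ _ ⟩₁ , _) (⟨ _ ⟩₁ , _) (⟨ _ ⟩₀ , _) r  ()
    parOrd-trans (⟨ _ ⟩₁ , _) (⟨ _ ⟩₁ , _) (⟨ _ ⟩₁ , _) r  s = Y.trans r s

    parOrd-antisym : ∀ a b → parOrd x y a b → parOrd x y b a → a ≡ b
    parOrd-antisym (⟨ _ ⟩₀ , _) (⟨ _ ⟩₀ , _) r  s = cong (ι₀ x y) (X.antisym r s)
    parOrd-antisym (⟨ _ ⟩₀ , _) (⟨ _ ⟩₁ , _) () s
    parOrd-antisym (⟨ _ ⟩₁ , _) (⟨ _ ⟩₀ , _) () s
    parOrd-antisym (⟨ _ ⟩₁ , _) (⟨ _ ⟩₁ , _) r  s = cong (ι₁ x y) (Y.antisym r s)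

    seqOrd-trans : ∀ a b c → seqOrd x y a b → seqOrd x y b c → seqOrd x y a c
    seqOrd-trans (⟨ _ ⟩₀ , _) (⟨ _ ⟩₀ , _) (⟨ _ ⟩₀ , _) r s =
      inj₂ (X.trans (same-block r) (same-block s))
    seqOrd-trans (⟨ _ ⟩₀ , _) _            (⟨ _ ⟩₁ , _) r s = inj₁ z<s
    seqOrd-trans (⟨ _ ⟩₀ , _) (⟨ _ ⟩₁ , _) (⟨ _ ⟩₀ , _) r s = backwards s
    seqOrd-trans (⟨ _ ⟩₁ , _) (⟨ _ ⟩₀ , _) _            r s = backwards r
    seqOrd-trans (⟨ _ ⟩₁ , _) (⟨ _ ⟩₁ , _) (⟨ _ ⟩₀ , _) r s = backwards s
    seqOrd-trans (⟨ _ ⟩₁ , _) (⟨ _ ⟩₁ , _) (⟨ _ ⟩₁ , _) r s =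
      inj₂ (Y.trans (same-block r) (same-block s))

    seqOrd-antisym : ∀ a b → seqOrd x y a b → seqOrd x y b a → a ≡ b
    seqOrd-antisym (⟨ _ ⟩₀ , _) (⟨ _ ⟩₀ , _) r s =
      cong (ι₀ x y) (X.antisym (same-block r) (same-block s))
    seqOrd-antisym (⟨ _ ⟩₀ , _) (⟨ _ ⟩₁ , _) r s = backwards s
    seqOrd-antisym (⟨ _ ⟩₁ , _) (⟨ _ ⟩₀ , _) r s = backwards r
    seqOrd-antisym (⟨ _ ⟩₁ , _) (⟨ _ ⟩₁ , _) r s =
      cong (ι₁ x y) (Y.antisym (same-block r) (same-block s))

    ∥ₛ-isPartialString : IsPartialString (x ∥ₛ y)
    ∥ₛ-isPartialString = record
      { isPreorder = record
        { isEquivalence = isEquivalence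
        ; reflexive     = λ { {a} refl → parOrd-refl a }
        ; trans         = λ {a} {b} {c} → parOrd-trans a b c
        }
      ; antisym = λ {a} {b} → parOrd-antisym a b
      }

    ⨾ₛ-isPartialString : IsPartialString (x ⨾ₛ y)
    ⨾ₛ-isPartialString = record
      { isPreorder = record
        { isEquivalence = isEquivalence
        ; reflexive     = λ { {a} refl → inj₂ (parOrd-refl a) }
        ; trans         = λ {a} {b} {c} → seqOrd-trans a b c
        }
      ; antisym = λ {a} {b} → seqOrd-antisym a b
      }

  ∥ₛ-Pf : ∀ {x y} → Pf x → Pf y → Pf (x ∥ₛ y)
  ∥ₛ-Pf {x} {y} (px , fx) (py , fy) = ∥ₛ-isPartialString x y px py , +ₑ-finite fx fy

  ⨾ₛ-Pf : ∀ {x y} → Pf x → Pf y → Pf (x ⨾ₛ y)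
  ⨾ₛ-Pf {x} {y} (px , fx) (py , fy) = ⨾ₛ-isPartialString x y px py , +ₑ-finite fx fy

  ⊥ₛ-Pf : Pf ⊥ₛ
  ⊥ₛ-Pf = record
    { isPreorder = record
      { isEquivalence = isEquivalence
      ; reflexive     = λ {a} _ → proj₂ a
      ; trans         = λ ()
      }
    ; antisym = λ ()
    }
    , [] , λ _ ()

  module _ {x x′ y y′ : PreStr} (f : x ⟶ x′) (g : y ⟶ y′) where
    private
      module F = Inverse (proj₁ (⟶⇒≅ f))
      module G = Inverse (proj₁ (⟶⇒≅ g))

    +-map : El (x ∥ₛ y) → El (x′ ∥ₛ y′)
    +-map (⟨ e ⟩₀ , p) = ι₀ x′ y′ (F.to (e , p))
    +-map (⟨ e ⟩₁ , p) = ι₁ x′ y′ (G.to (e , p))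

    +-unmap : El (x′ ∥ₛ y′) → El (x ∥ₛ y)
    +-unmap (⟨ e ⟩₀ , p) = ι₀ x y (F.from (e , p))
    +-unmap (⟨ e ⟩₁ , p) = ι₁ x y (G.from (e , p))

    +-map-≅ : (x ∥ₛ y) ≅ (x′ ∥ₛ y′)
    +-map-≅ = mk↔ₛ′ +-map +-unmap map∘unmap unmap∘map , label
      where
      map∘unmap : ∀ b → +-map (+-unmap b) ≡ b
      map∘unmap (⟨ e ⟩₀ , p) = cong (ι₀ x′ y′) (F.strictlyInverseˡ (e , p))
      map∘unmap (⟨ e ⟩₁ , p) = cong (ι₁ x′ y′) (G.strictlyInverseˡ (e , p))
      unmap∘map : ∀ a → +-unmap (+-map a) ≡ a
      unmap∘map (⟨ e ⟩₀ , p) = cong (ι₀ x y) (F.strictlyInverseʳ (e , p))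
      unmap∘map (⟨ e ⟩₁ , p) = cong (ι₁ x y) (G.strictlyInverseʳ (e , p))
      label : ∀ a → αSum x y a ≡ αSum x′ y′ (+-map a)
      label (⟨ e ⟩₀ , p) = _⟶_.lab f (e , p)
      label (⟨ e ⟩₁ , p) = _⟶_.lab g (e , p)

    +-map-parOrd : ∀ a b → parOrd x y a b → parOrd x′ y′ (+-map a) (+-map b)
    +-map-parOrd (⟨ _ ⟩₀ , _) (⟨ _ ⟩₀ , _) r = _⟶_.mono f r
    +-map-parOrd (⟨ _ ⟩₀ , _) (⟨ _ ⟩₁ , _) ()
    +-map-parOrd (⟨ _ ⟩₁ , _) (⟨ _ ⟩₀ , _) ()
    +-map-parOrd (⟨ _ ⟩₁ , _) (⟨ _ ⟩₁ , _) r = _⟶_.mono g r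

    +-map-seqOrd : ∀ a b → seqOrd x y a b → seqOrd x′ y′ (+-map a) (+-map b)
    +-map-seqOrd (⟨ _ ⟩₀ , _) (⟨ _ ⟩₀ , _) r = inj₂ (_⟶_.mono f (same-block r))
    +-map-seqOrd (⟨ _ ⟩₀ , _) (⟨ _ ⟩₁ , _) r = inj₁ z<s
    +-map-seqOrd (⟨ _ ⟩₁ , _) (⟨ _ ⟩₀ , _) r = backwards r
    +-map-seqOrd (⟨ _ ⟩₁ , _) (⟨ _ ⟩₁ , _) r = inj₂ (_⟶_.mono g (same-block r))

  ∥ₛ-⊑-mono : ∀ {x x′ y y′} → x′ ⊑ x → y′ ⊑ y → (x′ ∥ₛ y′) ⊑ (x ∥ₛ y)
  ∥ₛ-⊑-mono f g = ≅⇒⟶ (+-map-≅ f g) λ {a} {b} → +-map-parOrd f g a b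

  ⨾ₛ-⊑-mono : ∀ {x x′ y y′} → x′ ⊑ x → y′ ⊑ y → (x′ ⨾ₛ y′) ⊑ (x ⨾ₛ y)
  ⨾ₛ-⊑-mono f g = ≅⇒⟶ (+-map-≅ f g) λ {a} {b} → +-map-seqOrd f g a b

  module _ (x y z : PreStr) where
    reassoc : El ((x ∥ₛ y) ∥ₛ z) → El (x ∥ₛ (y ∥ₛ z))
    reassoc (⟨ e ⟩₁ , p) = ⟨ ⟨ e ⟩₁ ⟩₁ , p
    reassoc (⟨ ⟨ e ⟩₀ ⟩₀ , p) = ⟨ e ⟩₀ , p
    reassoc (⟨ ⟨ e ⟩₁ ⟩₀ , p) = ⟨ ⟨ e ⟩₀ ⟩₁ , p

    unreassoc : El (x ∥ₛ (y ∥ₛ z)) → El ((x ∥ₛ y) ∥ₛ z)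
    unreassoc (⟨ e ⟩₀ , p) = ⟨ ⟨ e ⟩₀ ⟩₀ , p
    unreassoc (⟨ ⟨ e ⟩₀ ⟩₁ , p) = ⟨ ⟨ e ⟩₁ ⟩₀ , p
    unreassoc (⟨ ⟨ e ⟩₁ ⟩₁ , p) = ⟨ e ⟩₁ , p

    reassoc-↔ : El ((x ∥ₛ y) ∥ₛ z) ↔ El (x ∥ₛ (y ∥ₛ z))
    reassoc-↔ = mk↔ₛ′ reassoc unreassoc
      (λ { (⟨ _ ⟩₀ , _) → refl
         ; (⟨ ⟨ _ ⟩₀ ⟩₁ , _) → refl
         ; (⟨ ⟨ _ ⟩₁ ⟩₁ , _) → refl })
      (λ { (⟨ ⟨ _ ⟩₀ ⟩₀ , _) → refl
         ; (⟨ ⟨ _ ⟩₁ ⟩₀ , _) → refl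
         ; (⟨ _ ⟩₁ , _) → refl })

    -- The labelling of a nested composition mentions the inner one, so unlike for +-map-≅
    -- and the units the label condition has to be checked separately for ∥ₛ and ⨾ₛ.
    ∥-reassoc-≅ : ((x ∥ₛ y) ∥ₛ z) ≅ (x ∥ₛ (y ∥ₛ z))
    ∥-reassoc-≅ = reassoc-↔ , λ
      { (⟨ ⟨ _ ⟩₀ ⟩₀ , _) → refl
      ; (⟨ ⟨ _ ⟩₁ ⟩₀ , _) → refl
      ; (⟨ _ ⟩₁ , _) → refl }

    ⨾-reassoc-≅ : ((x ⨾ₛ y) ⨾ₛ z) ≅ (x ⨾ₛ (y ⨾ₛ z))
    ⨾-reassoc-≅ = reassoc-↔ , λ
      { (⟨ ⟨ _ ⟩₀ ⟩₀ , _) → refl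
      ; (⟨ ⟨ _ ⟩₁ ⟩₀ , _) → refl
      ; (⟨ _ ⟩₁ , _) → refl }

    reassoc-parOrd : ∀ a b → parOrd (x ∥ₛ y) z a b → parOrd x (y ∥ₛ z) (reassoc a) (reassoc b)
    reassoc-parOrd (⟨ ⟨ _ ⟩₀ ⟩₀ , _) (⟨ ⟨ _ ⟩₀ ⟩₀ , _) r = r
    reassoc-parOrd (⟨ ⟨ _ ⟩₀ ⟩₀ , _) (⟨ ⟨ _ ⟩₁ ⟩₀ , _) ()
    reassoc-parOrd (⟨ ⟨ _ ⟩₀ ⟩₀ , _) (⟨ _ ⟩₁ , _)      ()
    reassoc-parOrd (⟨ ⟨ _ ⟩₁ ⟩₀ , _) (⟨ ⟨ _ ⟩₀ ⟩₀ , _) ()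
    reassoc-parOrd (⟨ ⟨ _ ⟩₁ ⟩₀ , _) (⟨ ⟨ _ ⟩₁ ⟩₀ , _) r = r
    reassoc-parOrd (⟨ ⟨ _ ⟩₁ ⟩₀ , _) (⟨ _ ⟩₁ , _)      ()
    reassoc-parOrd (⟨ _ ⟩₁ , _)      (⟨ ⟨ _ ⟩₀ ⟩₀ , _) ()
    reassoc-parOrd (⟨ _ ⟩₁ , _)      (⟨ ⟨ _ ⟩₁ ⟩₀ , _) ()
    reassoc-parOrd (⟨ _ ⟩₁ , _)      (⟨ _ ⟩₁ , _)      r = r

    unreassoc-parOrd : ∀ a b → parOrd x (y ∥ₛ z) a b → parOrd (x ∥ₛ y) z (unreassoc a) (unreassoc b)
    unreassoc-parOrd (⟨ _ ⟩₀ , _)      (⟨ _ ⟩₀ , _)      r = r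
    unreassoc-parOrd (⟨ _ ⟩₀ , _)      (⟨ ⟨ _ ⟩₀ ⟩₁ , _) ()
    unreassoc-parOrd (⟨ _ ⟩₀ , _)      (⟨ ⟨ _ ⟩₁ ⟩₁ , _) ()
    unreassoc-parOrd (⟨ ⟨ _ ⟩₀ ⟩₁ , _) (⟨ _ ⟩₀ , _)      ()
    unreassoc-parOrd (⟨ ⟨ _ ⟩₀ ⟩₁ , _) (⟨ ⟨ _ ⟩₀ ⟩₁ , _) r = r
    unreassoc-parOrd (⟨ ⟨ _ ⟩₀ ⟩₁ , _) (⟨ ⟨ _ ⟩₁ ⟩₁ , _) ()
    unreassoc-parOrd (⟨ ⟨ _ ⟩₁ ⟩₁ , _) (⟨ _ ⟩₀ , _)      ()
    unreassoc-parOrd (⟨ ⟨ _ ⟩₁ ⟩₁ , _) (⟨ ⟨ _ ⟩₀ ⟩₁ , _) ()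
    unreassoc-parOrd (⟨ ⟨ _ ⟩₁ ⟩₁ , _) (⟨ ⟨ _ ⟩₁ ⟩₁ , _) r = r

    reassoc-seqOrd : ∀ a b → seqOrd (x ⨾ₛ y) z a b → seqOrd x (y ⨾ₛ z) (reassoc a) (reassoc b)
    reassoc-seqOrd (⟨ ⟨ _ ⟩₀ ⟩₀ , _) (⟨ ⟨ _ ⟩₀ ⟩₀ , _) r = inj₂ (same-block (same-block r))
    reassoc-seqOrd (⟨ ⟨ _ ⟩₀ ⟩₀ , _) (⟨ ⟨ _ ⟩₁ ⟩₀ , _) r = inj₁ z<s
    reassoc-seqOrd (⟨ ⟨ _ ⟩₀ ⟩₀ , _) (⟨ _ ⟩₁ , _)      r = inj₁ z<s
    reassoc-seqOrd (⟨ ⟨ _ ⟩₁ ⟩₀ , _) (⟨ ⟨ _ ⟩₀ ⟩₀ , _) r = backwards (same-block r)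
    reassoc-seqOrd (⟨ ⟨ _ ⟩₁ ⟩₀ , _) (⟨ ⟨ _ ⟩₁ ⟩₀ , _) r = inj₂ (inj₂ (same-block (same-block r)))
    reassoc-seqOrd (⟨ ⟨ _ ⟩₁ ⟩₀ , _) (⟨ _ ⟩₁ , _)      r = inj₂ (inj₁ z<s)
    reassoc-seqOrd (⟨ _ ⟩₁ , _)      (⟨ ⟨ _ ⟩₀ ⟩₀ , _) r = backwards r
    reassoc-seqOrd (⟨ _ ⟩₁ , _)      (⟨ ⟨ _ ⟩₁ ⟩₀ , _) r = backwards r
    reassoc-seqOrd (⟨ _ ⟩₁ , _)      (⟨ _ ⟩₁ , _)      r = inj₂ (inj₂ (same-block r))

    unreassoc-seqOrd : ∀ a b → seqOrd x (y ⨾ₛ z) a b → seqOrd (x ⨾ₛ y) z (unreassoc a) (unreassoc b)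
    unreassoc-seqOrd (⟨ _ ⟩₀ , _)      (⟨ _ ⟩₀ , _)      r = inj₂ (inj₂ (same-block r))
    unreassoc-seqOrd (⟨ _ ⟩₀ , _)      (⟨ ⟨ _ ⟩₀ ⟩₁ , _) r = inj₂ (inj₁ z<s)
    unreassoc-seqOrd (⟨ _ ⟩₀ , _)      (⟨ ⟨ _ ⟩₁ ⟩₁ , _) r = inj₁ z<s
    unreassoc-seqOrd (⟨ ⟨ _ ⟩₀ ⟩₁ , _) (⟨ _ ⟩₀ , _)      r = backwards r
    unreassoc-seqOrd (⟨ ⟨ _ ⟩₀ ⟩₁ , _) (⟨ ⟨ _ ⟩₀ ⟩₁ , _) r = inj₂ (inj₂ (same-block (same-block r)))
    unreassoc-seqOrd (⟨ ⟨ _ ⟩₀ ⟩₁ , _) (⟨ ⟨ _ ⟩₁ ⟩₁ , _) r = inj₁ z<s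
    unreassoc-seqOrd (⟨ ⟨ _ ⟩₁ ⟩₁ , _) (⟨ _ ⟩₀ , _)      r = backwards r
    unreassoc-seqOrd (⟨ ⟨ _ ⟩₁ ⟩₁ , _) (⟨ ⟨ _ ⟩₀ ⟩₁ , _) r = backwards (same-block r)
    unreassoc-seqOrd (⟨ ⟨ _ ⟩₁ ⟩₁ , _) (⟨ ⟨ _ ⟩₁ ⟩₁ , _) r = inj₂ (same-block (same-block r))

  ∥ₛ-assoc : ∀ x y z → ((x ∥ₛ y) ∥ₛ z) ≃ (x ∥ₛ (y ∥ₛ z))
  ∥ₛ-assoc x y z = ≅⇒≃ (∥-reassoc-≅ x y z)
    (λ {a} {b} → reassoc-parOrd x y z a b) (λ {a} {b} → unreassoc-parOrd x y z a b)

  ⨾ₛ-assoc : ∀ x y z → ((x ⨾ₛ y) ⨾ₛ z) ≃ (x ⨾ₛ (y ⨾ₛ z))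
  ⨾ₛ-assoc x y z = ≅⇒≃ (⨾-reassoc-≅ x y z)
    (λ {a} {b} → reassoc-seqOrd x y z a b) (λ {a} {b} → unreassoc-seqOrd x y z a b)

  module _ (x b : PreStr) (b-empty : IsEmpty b) where
    dropʳ : El (x ∥ₛ b) → El x
    dropʳ (⟨ e ⟩₀ , p) = e , p
    dropʳ (⟨ e ⟩₁ , p) = ⊥-elim (b-empty (e , p))

    dropˡ : El (b ∥ₛ x) → El x
    dropˡ (⟨ e ⟩₁ , p) = e , p
    dropˡ (⟨ e ⟩₀ , p) = ⊥-elim (b-empty (e , p))

    unitʳ-≅ : x ≅ (x ∥ₛ b)
    unitʳ-≅ = mk↔ₛ′ (ι₀ x b) dropʳ
      (λ { (⟨ _ ⟩₀ , _) → refl ; (⟨ e ⟩₁ , p) → ⊥-elim (b-empty (e , p)) })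
      (λ _ → refl)
      , λ _ → refl

    unitˡ-≅ : x ≅ (b ∥ₛ x)
    unitˡ-≅ = mk↔ₛ′ (ι₁ b x) dropˡ
      (λ { (⟨ _ ⟩₁ , _) → refl ; (⟨ e ⟩₀ , p) → ⊥-elim (b-empty (e , p)) })
      (λ _ → refl)
      , λ _ → refl

    dropʳ-parOrd : ∀ a a′ → parOrd x b a a′ → _≼_ x (dropʳ a) (dropʳ a′)
    dropʳ-parOrd (⟨ _ ⟩₀ , _) (⟨ _ ⟩₀ , _) r = r
    dropʳ-parOrd (⟨ _ ⟩₀ , _) (⟨ e ⟩₁ , p) r = ⊥-elim (b-empty (e , p))
    dropʳ-parOrd (⟨ e ⟩₁ , p) _            r = ⊥-elim (b-empty (e , p))

    dropʳ-seqOrd : ∀ a a′ → seqOrd x b a a′ → _≼_ x (dropʳ a) (dropʳ a′)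
    dropʳ-seqOrd (⟨ _ ⟩₀ , _) (⟨ _ ⟩₀ , _) r = same-block r
    dropʳ-seqOrd (⟨ _ ⟩₀ , _) (⟨ e ⟩₁ , p) r = ⊥-elim (b-empty (e , p))
    dropʳ-seqOrd (⟨ e ⟩₁ , p) _            r = ⊥-elim (b-empty (e , p))

    dropˡ-parOrd : ∀ a a′ → parOrd b x a a′ → _≼_ x (dropˡ a) (dropˡ a′)
    dropˡ-parOrd (⟨ _ ⟩₁ , _) (⟨ _ ⟩₁ , _) r = r
    dropˡ-parOrd (⟨ _ ⟩₁ , _) (⟨ e ⟩₀ , p) r = ⊥-elim (b-empty (e , p))
    dropˡ-parOrd (⟨ e ⟩₀ , p) _            r = ⊥-elim (b-empty (e , p))

    dropˡ-seqOrd : ∀ a a′ → seqOrd b x a a′ → _≼_ x (dropˡ a) (dropˡ a′)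
    dropˡ-seqOrd (⟨ _ ⟩₁ , _) (⟨ _ ⟩₁ , _) r = same-block r
    dropˡ-seqOrd (⟨ _ ⟩₁ , _) (⟨ e ⟩₀ , p) r = ⊥-elim (b-empty (e , p))
    dropˡ-seqOrd (⟨ e ⟩₀ , p) _            r = ⊥-elim (b-empty (e , p))

  ∥ₛ-identityʳ : ∀ x b → IsEmpty b → x ≃ (x ∥ₛ b)
  ∥ₛ-identityʳ x b b-empty =
    ≅⇒≃ (unitʳ-≅ x b b-empty) (λ r → r) (λ {a} {a′} → dropʳ-parOrd x b b-empty a a′)

  ∥ₛ-identityˡ : ∀ b x → IsEmpty b → x ≃ (b ∥ₛ x)
  ∥ₛ-identityˡ b x b-empty =
    ≅⇒≃ (unitˡ-≅ x b b-empty) (λ r → r) (λ {a} {a′} → dropˡ-parOrd x b b-empty a a′)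

  ⨾ₛ-identityʳ : ∀ x b → IsEmpty b → x ≃ (x ⨾ₛ b)
  ⨾ₛ-identityʳ x b b-empty =
    ≅⇒≃ (unitʳ-≅ x b b-empty) inj₂ (λ {a} {a′} → dropʳ-seqOrd x b b-empty a a′)

  ⨾ₛ-identityˡ : ∀ b x → IsEmpty b → x ≃ (b ⨾ₛ x)
  ⨾ₛ-identityˡ b x b-empty =
    ≅⇒≃ (unitˡ-≅ x b b-empty) inj₂ (λ {a} {a′} → dropˡ-seqOrd x b b-empty a a′)

  transpose : ∀ p q r s → El ((p ∥ₛ q) ∥ₛ (r ∥ₛ s)) → El ((p ∥ₛ r) ∥ₛ (q ∥ₛ s))
  transpose _ _ _ _ (⟨ ⟨ e ⟩₀ ⟩₀ , t) = ⟨ ⟨ e ⟩₀ ⟩₀ , t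
  transpose _ _ _ _ (⟨ ⟨ e ⟩₀ ⟩₁ , t) = ⟨ ⟨ e ⟩₁ ⟩₀ , t
  transpose _ _ _ _ (⟨ ⟨ e ⟩₁ ⟩₀ , t) = ⟨ ⟨ e ⟩₀ ⟩₁ , t
  transpose _ _ _ _ (⟨ ⟨ e ⟩₁ ⟩₁ , t) = ⟨ ⟨ e ⟩₁ ⟩₁ , t

  transpose-involutive : ∀ p q r s a → transpose p r q s (transpose p q r s a) ≡ a
  transpose-involutive _ _ _ _ (⟨ ⟨ _ ⟩₀ ⟩₀ , _) = refl
  transpose-involutive _ _ _ _ (⟨ ⟨ _ ⟩₀ ⟩₁ , _) = refl
  transpose-involutive _ _ _ _ (⟨ ⟨ _ ⟩₁ ⟩₀ , _) = refl
  transpose-involutive _ _ _ _ (⟨ ⟨ _ ⟩₁ ⟩₁ , _) = refl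

  module _ (u x v y : PreStr) where
    exchange-≅ : ((u ⨾ₛ x) ∥ₛ (v ⨾ₛ y)) ≅ ((u ∥ₛ v) ⨾ₛ (x ∥ₛ y))
    exchange-≅ =
      mk↔ₛ′ (transpose u x v y) (transpose u v x y)
        (transpose-involutive u v x y) (transpose-involutive u x v y)
      , λ { (⟨ ⟨ _ ⟩₀ ⟩₀ , _) → refl
          ; (⟨ ⟨ _ ⟩₀ ⟩₁ , _) → refl
          ; (⟨ ⟨ _ ⟩₁ ⟩₀ , _) → refl
          ; (⟨ ⟨ _ ⟩₁ ⟩₁ , _) → refl }

    transpose-mono : ∀ a b → parOrd (u ⨾ₛ x) (v ⨾ₛ y) a b →
                     seqOrd (u ∥ₛ v) (x ∥ₛ y) (transpose u x v y a) (transpose u x v y b)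
    transpose-mono (⟨ ⟨ _ ⟩₀ ⟩₀ , _) (⟨ ⟨ _ ⟩₀ ⟩₀ , _) r = inj₂ (same-block r)
    transpose-mono (⟨ ⟨ _ ⟩₀ ⟩₀ , _) (⟨ ⟨ _ ⟩₁ ⟩₀ , _) r = inj₁ z<s
    transpose-mono (⟨ ⟨ _ ⟩₀ ⟩₀ , _) (⟨ ⟨ _ ⟩₀ ⟩₁ , _) ()
    transpose-mono (⟨ ⟨ _ ⟩₀ ⟩₀ , _) (⟨ ⟨ _ ⟩₁ ⟩₁ , _) ()
    transpose-mono (⟨ ⟨ _ ⟩₁ ⟩₀ , _) (⟨ ⟨ _ ⟩₀ ⟩₀ , _) r = backwards r
    transpose-mono (⟨ ⟨ _ ⟩₁ ⟩₀ , _) (⟨ ⟨ _ ⟩₁ ⟩₀ , _) r = inj₂ (same-block r)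
    transpose-mono (⟨ ⟨ _ ⟩₁ ⟩₀ , _) (⟨ ⟨ _ ⟩₀ ⟩₁ , _) ()
    transpose-mono (⟨ ⟨ _ ⟩₁ ⟩₀ , _) (⟨ ⟨ _ ⟩₁ ⟩₁ , _) ()
    transpose-mono (⟨ ⟨ _ ⟩₀ ⟩₁ , _) (⟨ ⟨ _ ⟩₀ ⟩₀ , _) ()
    transpose-mono (⟨ ⟨ _ ⟩₀ ⟩₁ , _) (⟨ ⟨ _ ⟩₁ ⟩₀ , _) ()
    transpose-mono (⟨ ⟨ _ ⟩₀ ⟩₁ , _) (⟨ ⟨ _ ⟩₀ ⟩₁ , _) r = inj₂ (same-block r)
    transpose-mono (⟨ ⟨ _ ⟩₀ ⟩₁ , _) (⟨ ⟨ _ ⟩₁ ⟩₁ , _) r = inj₁ z<s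
    transpose-mono (⟨ ⟨ _ ⟩₁ ⟩₁ , _) (⟨ ⟨ _ ⟩₀ ⟩₀ , _) ()
    transpose-mono (⟨ ⟨ _ ⟩₁ ⟩₁ , _) (⟨ ⟨ _ ⟩₁ ⟩₀ , _) ()
    transpose-mono (⟨ ⟨ _ ⟩₁ ⟩₁ , _) (⟨ ⟨ _ ⟩₀ ⟩₁ , _) r = backwards r
    transpose-mono (⟨ ⟨ _ ⟩₁ ⟩₁ , _) (⟨ ⟨ _ ⟩₁ ⟩₁ , _) r = inj₂ (same-block r)

  ∥ₛ-⨾ₛ-exchange : ∀ u x v y → ((u ∥ₛ v) ⨾ₛ (x ∥ₛ y)) ⊑ ((u ⨾ₛ x) ∥ₛ (v ⨾ₛ y))
  ∥ₛ-⨾ₛ-exchange u x v y = ≅⇒⟶ (exchange-≅ u x v y) λ {a} {b} → transpose-mono u x v y a b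

  record CompositionLaws (_⋈_ : Op₂ PreStr) : Set₁ where
    field
      Pf-closed : ∀ {x y} → Pf x → Pf y → Pf (x ⋈ y)
      ⊑-mono    : ∀ {x x′ y y′} → x′ ⊑ x → y′ ⊑ y → (x′ ⋈ y′) ⊑ (x ⋈ y)
      assoc     : ∀ x y z → ((x ⋈ y) ⋈ z) ≃ (x ⋈ (y ⋈ z))
      identityˡ : ∀ b x → IsEmpty b → x ≃ (b ⋈ x)
      identityʳ : ∀ x b → IsEmpty b → x ≃ (x ⋈ b)

  ∥ₛ-compositionLaws : CompositionLaws _∥ₛ_
  ∥ₛ-compositionLaws = record
    { Pf-closed = ∥ₛ-Pf ; ⊑-mono = ∥ₛ-⊑-mono ; assoc = ∥ₛ-assoc
    ; identityˡ = ∥ₛ-identityˡ ; identityʳ = ∥ₛ-identityʳ }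

  ⨾ₛ-compositionLaws : CompositionLaws _⨾ₛ_
  ⨾ₛ-compositionLaws = record
    { Pf-closed = ⨾ₛ-Pf ; ⊑-mono = ⨾ₛ-⊑-mono ; assoc = ⨾ₛ-assoc
    ; identityˡ = ⨾ₛ-identityˡ ; identityʳ = ⨾ₛ-identityʳ }

  ⊆ₚ-refl : ∀ {X} → X ⊆ₚ X
  ⊆ₚ-refl _ m = m

  ⊆ₚ-trans : ∀ {X Y Z} → X ⊆ₚ Y → Y ⊆ₚ Z → X ⊆ₚ Z
  ⊆ₚ-trans X⊆Y Y⊆Z z m = Y⊆Z z (X⊆Y z m)

  ≈ₚ-isEquivalence : IsEquivalence _≈ₚ_
  ≈ₚ-isEquivalence = record
    { refl  = λ {X} → ⊆ₚ-refl {X} , ⊆ₚ-refl {X}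
    ; sym   = swap
    ; trans = λ {X} {Y} {Z} (X⊆Y , Y⊆X) (Y⊆Z , Z⊆Y) →
        ⊆ₚ-trans {X} {Y} {Z} X⊆Y Y⊆Z , ⊆ₚ-trans {Z} {Y} {X} Z⊆Y Y⊆X
    }

  ⊆ₚ-isPartialOrder : IsPartialOrder _≈ₚ_ _⊆ₚ_
  ⊆ₚ-isPartialOrder = record
    { isPreorder = record
      { isEquivalence = ≈ₚ-isEquivalence
      ; reflexive     = proj₁
      ; trans         = λ {X} {Y} {Z} → ⊆ₚ-trans {X} {Y} {Z}
      }
    ; antisym = _,_
    }

  ⋃ₚ-supremum : ∀ {I : Set₁} (F : I → Program) → IsSupremum _⊆ₚ_ F (⋃ₚ F)
  ⋃ₚ-supremum F = (λ i _ m → i , m) , (λ _ F⊆U z (i , m) → F⊆U i z m)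

  ∪ₚ-supremum : Supremum _⊆ₚ_ _∪ₚ_
  ∪ₚ-supremum X Y = (λ _ → inj₁) , (λ _ → inj₂) , λ { Z X⊆Z Y⊆Z z (inj₁ m) → X⊆Z z m
                                                   ; Z X⊆Z Y⊆Z z (inj₂ m) → Y⊆Z z m }

  ↓-closed : ∀ X {x z} → mem X x → Pf z → z ⊑ x → mem X z
  ↓-closed X {x} {z} mx pf z⊑x = proj₁ (closed X z) (pf , x , mx , z⊑x)

  ⊥ₛ∈1ₚ : mem 1ₚ ⊥ₛ
  ⊥ₛ∈1ₚ = ⊥ₛ-Pf , ⊥ₛ , refl , ⊑-refl ⊥ₛ

  module _ (_⋈_ : Op₂ PreStr) where
    lift₂-intro : ∀ {X Y x y z} → mem X x → mem Y y → Pf z → z ⊑ (x ⋈ y) → mem (lift₂ _⋈_ X Y) z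
    lift₂-intro {x = x} {y} mx my pf z⊑xy = pf , x ⋈ y , (x , y , mx , my , refl) , z⊑xy

    lift₂-mono : ∀ {X X′ Y Y′} → X ⊆ₚ X′ → Y ⊆ₚ Y′ → lift₂ _⋈_ X Y ⊆ₚ lift₂ _⋈_ X′ Y′
    lift₂-mono {X′ = X′} {Y′ = Y′} X⊆X′ Y⊆Y′ _ (pf , _ , (x , y , mx , my , refl) , z⊑xy) =
      lift₂-intro {X′} {Y′} (X⊆X′ x mx) (Y⊆Y′ y my) pf z⊑xy

  module _ {_⋈_ : Op₂ PreStr} (laws : CompositionLaws _⋈_) where
    open CompositionLaws laws

    private
      _⋆_ : Op₂ Program
      _⋆_ = lift₂ _⋈_

    ⋈-∈-lift₂ : ∀ {X Y x y} → mem X x → mem Y y → mem (X ⋆ Y) (x ⋈ y)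
    ⋈-∈-lift₂ {X} {Y} {x} {y} mx my =
      lift₂-intro _⋈_ {X} {Y} mx my (Pf-closed (⊆Pf X x mx) (⊆Pf Y y my)) (⊑-refl (x ⋈ y))

    lift₂-assocˡ : ∀ X Y Z → ((X ⋆ Y) ⋆ Z) ⊆ₚ (X ⋆ (Y ⋆ Z))
    lift₂-assocˡ X Y Z _
      (pf , _ , (a , c , (_ , _ , (x , y , mx , my , refl) , a⊑xy) , mc , refl) , z⊑ac) =
      lift₂-intro _⋈_ {X} {Y ⋆ Z} mx (⋈-∈-lift₂ {Y} {Z} my mc) pf
        (⊑-trans z⊑ac (⊑-trans (⊑-mono a⊑xy (⊑-refl c)) (proj₁ (assoc x y c))))

    lift₂-assocʳ : ∀ X Y Z → (X ⋆ (Y ⋆ Z)) ⊆ₚ ((X ⋆ Y) ⋆ Z)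
    lift₂-assocʳ X Y Z _
      (pf , _ , (x , a , mx , (_ , _ , (y , c , my , mc , refl) , a⊑yc) , refl) , z⊑xa) =
      lift₂-intro _⋈_ {X ⋆ Y} {Z} (⋈-∈-lift₂ {X} {Y} mx my) mc pf
        (⊑-trans z⊑xa (⊑-trans (⊑-mono (⊑-refl x) a⊑yc) (proj₂ (assoc x y c))))

    lift₂-identityˡ : ∀ X → (1ₚ ⋆ X) ≈ₚ X
    lift₂-identityˡ X =
      (λ { _ (pf , _ , (b , x , (_ , _ , refl , b⊑⊥) , mx , refl) , z⊑bx) →
             ↓-closed X mx pf (⊑-trans z⊑bx (proj₂ (identityˡ b x (⊑⊥ₛ⇒isEmpty b⊑⊥)))) })
      , λ z mz → lift₂-intro _⋈_ {1ₚ} {X} ⊥ₛ∈1ₚ mz (⊆Pf X z mz) (proj₁ (identityˡ ⊥ₛ z ⊥ₛ-isEmpty))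

    lift₂-identityʳ : ∀ X → (X ⋆ 1ₚ) ≈ₚ X
    lift₂-identityʳ X =
      (λ { _ (pf , _ , (x , b , mx , (_ , _ , refl , b⊑⊥) , refl) , z⊑xb) →
             ↓-closed X mx pf (⊑-trans z⊑xb (proj₂ (identityʳ x b (⊑⊥ₛ⇒isEmpty b⊑⊥)))) })
      , λ z mz → lift₂-intro _⋈_ {X} {1ₚ} mz ⊥ₛ∈1ₚ (⊆Pf X z mz) (proj₁ (identityʳ z ⊥ₛ ⊥ₛ-isEmpty))

    lift₂-distribˡ : ∀ {I : Set₁} X (F : I → Program) → (X ⋆ ⋃ₚ F) ≈ₚ ⋃ₚ (λ i → X ⋆ F i)
    lift₂-distribˡ X F =
      (λ { _ (pf , w , (x , y , mx , (i , my) , eq) , z⊑w) → i , pf , w , (x , y , mx , my , eq) , z⊑w })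
      , λ { _ (i , pf , w , (x , y , mx , my , eq) , z⊑w) → pf , w , (x , y , mx , (i , my) , eq) , z⊑w }

    lift₂-distribʳ : ∀ {I : Set₁} X (F : I → Program) → (⋃ₚ F ⋆ X) ≈ₚ ⋃ₚ (λ i → F i ⋆ X)
    lift₂-distribʳ X F =
      (λ { _ (pf , w , (y , x , (i , my) , mx , eq) , z⊑w) → i , pf , w , (y , x , my , mx , eq) , z⊑w })
      , λ { _ (i , pf , w , (y , x , my , mx , eq) , z⊑w) → pf , w , (y , x , (i , my) , mx , eq) , z⊑w }

    lift₂-isUnitalQuantale : IsUnitalQuantale _≈ₚ_ _⊆ₚ_ ⋃ₚ _⋆_ 1ₚ
    lift₂-isUnitalQuantale = record
      { isPartialOrder = ⊆ₚ-isPartialOrder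
      ; ⋁-supremum     = ⋃ₚ-supremum
      ; isMonoid       = record
        { isSemigroup = record
          { isMagma = record
            { isEquivalence = ≈ₚ-isEquivalence
            ; ∙-cong        = λ {X} {X′} {Y} {Y′} (X⊆X′ , X′⊆X) (Y⊆Y′ , Y′⊆Y) →
                lift₂-mono _⋈_ {X} {X′} {Y} {Y′} X⊆X′ Y⊆Y′ , lift₂-mono _⋈_ {X′} {X} {Y′} {Y} X′⊆X Y′⊆Y
            }
          ; assoc = λ X Y Z → lift₂-assocˡ X Y Z , lift₂-assocʳ X Y Z
          }
        ; identity = lift₂-identityˡ , lift₂-identityʳ
        }
      ; distribˡ = lift₂-distribˡ
      ; distribʳ = lift₂-distribʳ
      }

  ∥ₚ-⨾ₚ-exchange : ∀ U V X Y → ((U ∥ₚ V) ⨾ₚ (X ∥ₚ Y)) ⊆ₚ ((U ⨾ₚ X) ∥ₚ (V ⨾ₚ Y))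
  ∥ₚ-⨾ₚ-exchange U V X Y _
    (pf , _ , (a , b , (_ , _ , (u , v , mu , mv , refl) , a⊑uv)
                     , (_ , _ , (x , y , mx , my , refl) , b⊑xy) , refl) , z⊑ab) =
    lift₂-intro _∥ₛ_ {U ⨾ₚ X} {V ⨾ₚ Y} (⋈-∈-lift₂ ⨾ₛ-compositionLaws {U} {X} mu mx)
      (⋈-∈-lift₂ ⨾ₛ-compositionLaws {V} {Y} mv my) pf
      (⊑-trans z⊑ab (⊑-trans (⨾ₛ-⊑-mono a⊑uv b⊑xy) (∥ₛ-⨾ₛ-exchange u x v y)))

mainTheorem19 : (Γ : Set) → let open Programs Γ in
    IsUnitalQuantale _≈ₚ_ _⊆ₚ_ ⋃ₚ _⨾ₚ_ 1ₚ
    × IsUnitalQuantale _≈ₚ_ _⊆ₚ_ ⋃ₚ _∥ₚ_ 1ₚ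
    × Supremum _⊆ₚ_ _∪ₚ_
    × (∀ U V X Y → ((U ∥ₚ V) ⨾ₚ (X ∥ₚ Y)) ⊆ₚ ((U ⨾ₚ X) ∥ₚ (V ⨾ₚ Y)))
mainTheorem19 Γ =
    lift₂-isUnitalQuantale ⨾ₛ-compositionLaws
  , lift₂-isUnitalQuantale ∥ₛ-compositionLaws
  , ∪ₚ-supremum
  , ∥ₚ-⨾ₚ-exchange
  where open PartialStringQuantales Γ
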